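{- Let $\mathbf{p}$ be a $q$-fixing random projection from $x_1,\dots,x_n$ to $y_1,\dots,y_m$. Let $f_1,f_2\colon\{0,1\}^n\to\{0,1\}$, let $\sigma,\tau\in\{0,1\}$, and let $y_j$ be one of the variables $y_1,\dots,y_m$. Then \[\Pr\!\left[L(f_2|_{\mathbf{p}_{y_j\gets\sigma}})=1\;\middle|\;f_1|_{\mathbf{p}}=y_j^{\tau}\right]\le q\cdot\sqrt{L(f_2)}.\]
   Context: For a Boolean variable $z$, $z^0$ and $z^1$ denote the literals $z$ and $\overline{z}$ respectively. $L(f)$ is the minimal number of leaves of a De Morgan formula (binary tree, leaves labeled by literals, internal nodes AND/OR) computing $f$; $L$ of a constant is $0$. A projection $\pi$ from $x_1,\dots,x_n$ to $y_1,\dots,y_m$ is a map $\{x_1,\dots,x_n\}\to\{0,1,y_1,\overline{y_1},\dots,y_m,\overline{y_m}\}$, and $f|_\pi$ is the function of $y_1,\dots,y_m$ obtained by substituting $\pi(x_i)$ for $x_i$. A random projection is a distribution over projections. $\pi_{y_j\gets\sigma}$ denotes $\pi$ with $y_j$ substituted by $\sigma\in\{0,1\}$, and $\mathrm{var}(\ell)$ is the variable underlying a literal $\ell$. A random projection $\mathbf{p}$ is $(q_0,q_1)$-fixing if for all projections $\pi$, $\sigma\in\{0,1\}$ and variables $x_i$: $\Pr[\mathbf{p}(x_i)\notin\{0,1\}\text{ and }\mathbf{p}_{\mathrm{var}(\mathbf{p}(x_i))\gets\sigma}=\pi]\le q_\sigma\Pr[\mathbf{p}=\pi]$; it is $q$-fixing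 if it is $(q_0,q_1)$-fixing with $q=\sqrt{q_0q_1}$.
   Formalization: The random projection $\mathbf{p}$ has rational probabilities, and the fixing parameters q₀ and q₁ are rational. -}

module Defs where

open import Data.Bool using (Bool; true; false; _xor_; not; _∧_; _∨_)
open import Data.Nat using (ℕ; zero; suc)
import Data.Nat as ℕ
open import Data.Fin using (Fin; _≟_)
open import Data.Vec using (Vec; lookup; map)
open import Data.List using (List; []; _∷_)
open import Data.List.Relation.Unary.All using (All)
open import Data.Product using (_×_; _,_; ∃; ∃-syntax; proj₂)
open import Data.Sum using (_⊎_)
open import Data.Rational using (ℚ; 0ℚ; 1ℚ; _+_; _*_; _≤_)
open import Relation.Nullary using (¬_; yes; no)
open import Relation.Binary.PropositionalEquality using (_≡_)

BoolFun : ℕ → Set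
BoolFun n = Vec Bool n → Bool

_≗f_ : ∀ {n} → BoolFun n → BoolFun n → Set
f ≗f g = ∀ a → f a ≡ g a

-- The literal z^b : b = false gives z, b = true gives ¬z.
litVal : Bool → Bool → Bool
litVal z b = z xor b

literalFun : ∀ {m} → Fin m → Bool → BoolFun m
literalFun j τ a = litVal (lookup a j) τ

data Formula (m : ℕ) : Set where
  leaf : Fin m → Bool → Formula m
  and  : Formula m → Formula m → Formula m
  or   : Formula m → Formula m → Formula m

leaves : ∀ {m} → Formula m → ℕ
leaves (leaf _ _) = 1
leaves (and φ ψ) = leaves φ ℕ.+ leaves ψ
leaves (or φ ψ)  = leaves φ ℕ.+ leaves ψ

evalF : ∀ {m} → Formula m → BoolFun m
evalF (leaf j b) a = litVal (lookup a j) b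
evalF (and φ ψ) a = evalF φ a ∧ evalF ψ a
evalF (or φ ψ) a  = evalF φ a ∨ evalF ψ a

Constant : ∀ {m} → BoolFun m → Set
Constant f = ∃[ b ] (∀ a → f a ≡ b)

IsL : ∀ {m} → BoolFun m → ℕ → Set
IsL {m} f s =
  (Constant f × s ≡ 0)
  ⊎ (¬ Constant f
     × (∃[ φ ] (leaves φ ≡ s × evalF φ ≗f f))
     × (∀ (φ : Formula m) → evalF φ ≗f f → s ℕ.≤ leaves φ))

data Target (m : ℕ) : Set where
  cst : Bool → Target m
  var : Fin m → Bool → Target m

Projection : ℕ → ℕ → Set
Projection n m = Vec (Target m) n

evalT : ∀ {m} → Vec Bool m → Target m → Bool
evalT a (cst b)   = b
evalT a (var j b) = litVal (lookup a j) b

restrict : ∀ {n m} → BoolFun n → Projection n m → BoolFun m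
restrict f π a = f (map (evalT a) π)

substT : ∀ {m} → Fin m → Bool → Target m → Target m
substT j σ (cst b) = cst b
substT j σ (var k b) with k ≟ j
... | yes _ = cst (litVal σ b)
... | no  _ = var k b

substP : ∀ {n m} → Projection n m → Fin m → Bool → Projection n m
substP π j σ = map (substT j σ) π

RandProj : ℕ → ℕ → Set
RandProj n m = List (Projection n m × ℚ)

totalWeight : ∀ {n m} → RandProj n m → ℚ
totalWeight [] = 0ℚ
totalWeight ((_ , w) ∷ D) = w + totalWeight D

IsDistribution : ∀ {n m} → RandProj n m → Set
IsDistribution D = All (λ e → 0ℚ ≤ proj₂ e) D × totalWeight D ≡ 1ℚ

-- Mass D E w  :⇔  Pr_{p∼D}[E(p)] = w
data Mass {n m} : RandProj n m → (Projection n m → Set) → ℚ → Set₁ where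
  mass-[] : ∀ {E} → Mass [] E 0ℚ
  mass-in  : ∀ {π w D E r} → E π → Mass D E r → Mass ((π , w) ∷ D) E (w + r)
  mass-out : ∀ {π w D E r} → ¬ E π → Mass D E r → Mass ((π , w) ∷ D) E r

IsFixing : ∀ {n m} → RandProj n m → ℚ → ℚ → Set₁
IsFixing {n} {m} D q₀ q₁ =
  ∀ (π : Projection n m) (σ : Bool) (i : Fin n) (a b : ℚ) →
    Mass D (λ p → ∃[ k ] ∃[ c ] (lookup p i ≡ var k c × substP p k σ ≡ π)) a →
    Mass D (λ p → p ≡ π) b →
    a ≤ (if-σ σ) * b
  where
    if-σ : Bool → ℚ
    if-σ false = q₀
    if-σ true  = q₁

{-# OPTIONS --safe #-}
module Submission where

-- Khrapchenko's argument, run on projections instead of inputs.  Let A and B be the parts of the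
-- event f₁|p = y_j^τ on which f₂ is 1 resp. 0 at the input induced by p (y = 0 except y_j = σ).
-- If moreover f₂|p_{y_j←σ} is a literal y_k^ρ, then k ≠ j, both p_{y_k←0} and p_{y_k←1} still
-- satisfy f₁|· = y_j^τ, and f₂ separates them: p is an edge between A and B.  Induction on a
-- formula for f₂ bounds the squared weight of any set of such edges by 4 q₀ q₁ L(f₂) Pr[A] Pr[B].
-- At a leaf x_i an edge forces p(x_i) to be a literal of y_k, so p is fixed toward both of its
-- endpoints and the q-fixing property bounds the edges by q₀ Pr[A], q₁ Pr[B] and symmetrically;
-- a gate splits the edges by the value of one subformula and the halves recombine by
-- Cauchy–Schwarz.  Finally 4 Pr[A] Pr[B] ≤ (Pr[A] + Pr[B])² ≤ b².

open import Defs
open import Data.Bool using (Bool; true; false; _∧_; _∨_; not; _xor_; if_then_else_)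
import Data.Bool as Bool
import Data.Bool.Properties as Bool
open import Data.Nat using (ℕ; zero; suc)
import Data.Nat as ℕ
import Data.Nat.Properties as ℕ
import Data.Nat.Coprimality as Coprime
open import Data.Fin using (Fin)
import Data.Fin as Fin
open import Data.Fin.Properties using (any?)
open import Data.Integer using (+_)
import Data.Integer as ℤ
import Data.Integer.Properties as ℤ
open import Data.Vec using (Vec; []; _∷_; lookup; map; replicate; _[_]≔_)
import Data.Vec.Properties as Vec
open import Data.List using (List; []; _∷_)
import Data.List as List
open import Data.List.Relation.Unary.All as All using (All; []; _∷_)
open import Data.List.Relation.Unary.Any using (here; there)
open import Data.List.Relation.Unary.Any.Properties using (¬Any[])
open import Data.List.Membership.Propositional using (_∈_)
open import Data.List.Membership.Propositional.Properties using (∈-map⁺)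
open import Data.Product using (_×_; _,_; ∃-syntax; proj₁; proj₂)
open import Data.Sum using (inj₁; inj₂)
open import Data.Rational using (ℚ; mkℚ; 0ℚ; _+_; _*_; _-_; _≤_; _<_; _/_; nonNegative; nonPositive; positive)
open import Data.Rational.Properties
open import Data.Rational.Solver using (module +-*-Solver)
open import Function using (_∘_)
open import Relation.Binary.Definitions using (DecidableEquality)
open import Relation.Binary.PropositionalEquality
open import Relation.Nullary using (¬_; Dec; does; yes; no; contradiction; _×-dec_; _⊎-dec_)
open import Relation.Nullary.Decidable using (map′; dec-true)
open import Relation.Unary using (Decidable)

open +-*-Solver using (solve; _:=_; _:+_; _:-_; _:*_; con)

toℚ : ℕ → ℚ
toℚ n = + n / 1

toℚ-nonNeg : ∀ n → 0ℚ ≤ toℚ n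
toℚ-nonNeg n = nonNegative⁻¹ (toℚ n) {{normalize-nonNeg n 1}}

toℚ-+ : ∀ m n → toℚ (m ℕ.+ n) ≡ toℚ m + toℚ n
toℚ-+ m n = begin
  + (m ℕ.+ n) / 1                   ≡⟨ /-cong (sym (cong₂ ℤ._+_ (ℤ.*-identityʳ (+ m)) (ℤ.*-identityʳ (+ n)))) refl ⟩
  (+ m ℤ.* + 1 ℤ.+ + n ℤ.* + 1) / 1 ≡⟨ cong₂ _+_ (toℚ-mkℚ m) (toℚ-mkℚ n) ⟨
  toℚ m + toℚ n                     ∎
  where
  open ≡-Reasoning
  toℚ-mkℚ : ∀ k → toℚ k ≡ mkℚ (+ k) 0 _
  toℚ-mkℚ k = normalize-coprime (Coprime.sym (Coprime.1-coprimeTo k))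

*-nonNeg : ∀ {p q} → 0ℚ ≤ p → 0ℚ ≤ q → 0ℚ ≤ p * q
*-nonNeg {p} {q} p≥0 q≥0 =
  nonNegative⁻¹ _ {{nonNeg*nonNeg⇒nonNeg p {{nonNegative p≥0}} q {{nonNegative q≥0}}}}

square-nonNeg : ∀ p → 0ℚ ≤ p * p
square-nonNeg p with ≤-total 0ℚ p
... | inj₁ p≥0 = *-nonNeg p≥0 p≥0
... | inj₂ p≤0 = nonNegative⁻¹ _ {{nonPos*nonPos⇒nonPos p {{nonPositive p≤0}} p {{nonPositive p≤0}}}}

*-mono-≤-nonNeg : ∀ {p q r s} → 0ℚ ≤ p → 0ℚ ≤ r → p ≤ q → r ≤ s → p * r ≤ q * s
*-mono-≤-nonNeg {p} {q} {r} {s} p≥0 r≥0 p≤q r≤s =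
  ≤-trans (*-monoʳ-≤-nonNeg r {{nonNegative r≥0}} p≤q)
          (*-monoˡ-≤-nonNeg q {{nonNegative (≤-trans p≥0 p≤q)}} r≤s)

square-cancel-≤ : ∀ {p q} → 0ℚ ≤ q → p * p ≤ q * q → p ≤ q
square-cancel-≤ {p} {q} q≥0 p²≤q² with p ≤? q
... | yes p≤q = p≤q
... | no  p≰q = contradiction (<-≤-trans q²<p² p²≤q²) (<-irrefl refl)
  where
  q<p = ≰⇒> p≰q
  q²<p² : q * q < p * p
  q²<p² = ≤-<-trans (*-monoˡ-≤-nonNeg q {{nonNegative q≥0}} (<⇒≤ q<p))
                    (*-monoˡ-<-pos p {{positive (≤-<-trans q≥0 q<p)}} q<p)

≤-+-square : ∀ p r → p ≤ p + r * r
≤-+-square p r = ≤-trans (≤-reflexive (sym (+-identityʳ p))) (+-monoʳ-≤ p (square-nonNeg r))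

-- (p + q)² − 4pq = (p − q)²
four-*-≤-square-+ : ∀ p q → toℚ 4 * p * q ≤ (p + q) * (p + q)
four-*-≤-square-+ p q = ≤-trans (≤-+-square _ (p - q)) (≤-reflexive
  (solve 2 (λ p q → con (toℚ 4) :* p :* q :+ (p :- q) :* (p :- q) := (p :+ q) :* (p :+ q)) refl p q))

square-+-≤ : ∀ p q → (p + q) * (p + q) ≤ toℚ 2 * (p * p) + toℚ 2 * (q * q)
square-+-≤ p q = ≤-trans (≤-+-square _ (p - q)) (≤-reflexive
  (solve 2 (λ p q → (p :+ q) :* (p :+ q) :+ (p :- q) :* (p :- q)
                 := con (toℚ 2) :* (p :* p) :+ con (toℚ 2) :* (q :* q)) refl p q))

-- The cross term is bounded through (2xy)² ≤ 4(αδ)(γβ) ≤ (αδ + γβ)².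
cauchy-schwarz₂ : ∀ x y {α β γ δ} → 0ℚ ≤ α → 0ℚ ≤ β → 0ℚ ≤ γ → 0ℚ ≤ δ →
  x * x ≤ α * β → y * y ≤ γ * δ → (x + y) * (x + y) ≤ (α + γ) * (β + δ)
cauchy-schwarz₂ x y {α} {β} {γ} {δ} α≥0 β≥0 γ≥0 δ≥0 x²≤αβ y²≤γδ = begin
  (x + y) * (x + y)         ≡⟨ solve 2 (λ x y → (x :+ y) :* (x :+ y) := (x :* x :+ y :* y) :+ con (toℚ 2) :* x :* y)
                                       refl x y ⟩
  (x * x + y * y) + 2xy     ≤⟨ +-mono-≤ (+-mono-≤ x²≤αβ y²≤γδ) 2xy≤αδ+γβ ⟩
  (α * β + γ * δ) + αδ+γβ   ≡⟨ solve 4 (λ α β γ δ → (α :* β :+ γ :* δ) :+ (α :* δ :+ γ :* β) := (α :+ γ) :* (β :+ δ))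
                                       refl α β γ δ ⟩
  (α + γ) * (β + δ)         ∎
  where
  open ≤-Reasoning
  2xy = toℚ 2 * x * y
  αδ+γβ = α * δ + γ * β
  2xy≤αδ+γβ : 2xy ≤ αδ+γβ
  2xy≤αδ+γβ = square-cancel-≤ (+-mono-≤ (*-nonNeg α≥0 δ≥0) (*-nonNeg γ≥0 β≥0)) (begin
    2xy * 2xy                    ≡⟨ solve 2 (λ x y → (con (toℚ 2) :* x :* y) :* (con (toℚ 2) :* x :* y)
                                                  := con (toℚ 4) :* ((x :* x) :* (y :* y))) refl x y ⟩
    toℚ 4 * ((x * x) * (y * y))  ≤⟨ *-monoˡ-≤-nonNeg (toℚ 4) {{normalize-nonNeg 4 1}}
                                      (*-mono-≤-nonNeg (square-nonNeg x) (square-nonNeg y) x²≤αβ y²≤γδ) ⟩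
    toℚ 4 * ((α * β) * (γ * δ))  ≡⟨ solve 4 (λ α β γ δ → con (toℚ 4) :* ((α :* β) :* (γ :* δ))
                                                      := con (toℚ 4) :* (α :* δ) :* (γ :* β)) refl α β γ δ ⟩
    toℚ 4 * (α * δ) * (γ * β)    ≤⟨ four-*-≤-square-+ (α * δ) (γ * β) ⟩
    αδ+γβ * αδ+γβ                ∎)

not-true : ∀ {x} → not x ≡ true → x ≡ false
not-true {false} _ = refl

∧-false-true : ∀ {x y} → x ∧ y ≡ false → y ≡ true → x ≡ false
∧-false-true {x} x∧y≡false refl = trans (sym (Bool.∧-identityʳ x)) x∧y≡false

∨-true-false : ∀ {x y} → x ∨ y ≡ true → x ≡ false → y ≡ true
∨-true-false x∨y≡true refl = x∨y≡true

does-true⇒ : ∀ {A : Set} (a? : Dec A) → does a? ≡ true → A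
does-true⇒ (yes a) _ = a

NonNegWeights : ∀ {A : Set} → List (A × ℚ) → Set
NonNegWeights = All (λ e → 0ℚ ≤ proj₂ e)

if-≤ : ∀ b {w} → 0ℚ ≤ w → (if b then w else 0ℚ) ≤ w
if-≤ true  _   = ≤-refl
if-≤ false w≥0 = w≥0

if-nonNeg : ∀ b {w} → 0ℚ ≤ w → 0ℚ ≤ (if b then w else 0ℚ)
if-nonNeg true  w≥0 = w≥0
if-nonNeg false _   = ≤-refl

module _ {A : Set} where

  weight : List (A × ℚ) → (A → Bool) → ℚ
  weight []            S = 0ℚ
  weight ((x , w) ∷ D) S = (if S x then w else 0ℚ) + weight D S

  weight-nonNeg : ∀ {D} → NonNegWeights D → ∀ S → 0ℚ ≤ weight D S
  weight-nonNeg []                        S = ≤-refl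
  weight-nonNeg {(x , w) ∷ D} (w≥0 ∷ D≥0) S = +-mono-≤ (if-nonNeg (S x) w≥0) (weight-nonNeg D≥0 S)

  weight-mono : ∀ {D} → NonNegWeights D → ∀ {S T} → (∀ x → S x ≡ true → T x ≡ true) → weight D S ≤ weight D T
  weight-mono []                                  S⊆T = ≤-refl
  weight-mono {(x , w) ∷ D} (w≥0 ∷ D≥0) {S} {T} S⊆T = +-mono-≤ (head (S x) refl) (weight-mono D≥0 S⊆T)
    where
    head : ∀ b → S x ≡ b → (if b then w else 0ℚ) ≤ (if T x then w else 0ℚ)
    head true  Sx rewrite S⊆T x Sx = ≤-refl
    head false _  = if-nonNeg (T x) w≥0

  weight-cong : ∀ D {S T} → (∀ x → S x ≡ T x) → weight D S ≡ weight D T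
  weight-cong []            S≗T = refl
  weight-cong ((x , w) ∷ D) S≗T = cong₂ _+_ (cong (if_then w else 0ℚ) (S≗T x)) (weight-cong D S≗T)

  weight-≤-weight-∷ : ∀ {x w} → 0ℚ ≤ w → ∀ D S → weight D S ≤ weight ((x , w) ∷ D) S
  weight-≤-weight-∷ {x} w≥0 D S =
    ≤-trans (≤-reflexive (sym (+-identityˡ _))) (+-monoˡ-≤ _ (if-nonNeg (S x) w≥0))

  weight-zero : ∀ {D : List (A × ℚ)} {S} → All (λ e → S (proj₁ e) ≡ false) D → weight D S ≡ 0ℚ
  weight-zero []        = refl
  weight-zero (Sx ∷ Ss) rewrite Sx | weight-zero Ss = refl

  weight-split : ∀ D (S T : A → Bool) →
    weight D S ≡ weight D (λ x → S x ∧ T x) + weight D (λ x → S x ∧ not (T x))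
  weight-split []            S T = refl
  weight-split ((x , w) ∷ D) S T rewrite weight-split D S T = head (S x) (T x)
    where
    a = weight D (λ x → S x ∧ T x)
    b = weight D (λ x → S x ∧ not (T x))
    head : ∀ s t → (if s then w else 0ℚ) + (a + b)
                 ≡ ((if s ∧ t then w else 0ℚ) + a) + ((if s ∧ not t then w else 0ℚ) + b)
    head true  true  = solve 3 (λ w a b → w :+ (a :+ b) := (w :+ a) :+ (con 0ℚ :+ b)) refl w a b
    head true  false = solve 3 (λ w a b → w :+ (a :+ b) := (con 0ℚ :+ a) :+ (w :+ b)) refl w a b
    head false _     = solve 2 (λ a b → con 0ℚ :+ (a :+ b) := (con 0ℚ :+ a) :+ (con 0ℚ :+ b)) refl a b

module _ {n m : ℕ} where

  mass-nonNeg : ∀ {D : RandProj n m} {E r} → NonNegWeights D → Mass D E r → 0ℚ ≤ r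
  mass-nonNeg []          mass-[]        = ≤-refl
  mass-nonNeg (w≥0 ∷ D≥0) (mass-in _ M)  = +-mono-≤ w≥0 (mass-nonNeg D≥0 M)
  mass-nonNeg (_ ∷ D≥0)   (mass-out _ M) = mass-nonNeg D≥0 M

  mass-empty : ∀ {D : RandProj n m} {E r} → (∀ π → ¬ E π) → Mass D E r → r ≡ 0ℚ
  mass-empty ¬E mass-[]        = refl
  mass-empty ¬E (mass-in e _)  = contradiction e (¬E _)
  mass-empty ¬E (mass-out _ M) = mass-empty ¬E M

  mass-≤-weight : ∀ {D : RandProj n m} {E r} → NonNegWeights D → Mass D E r →
    ∀ {S} → (∀ π → E π → S π ≡ true) → r ≤ weight D S
  mass-≤-weight []          mass-[]                    E⊆S = ≤-refl
  mass-≤-weight (_ ∷ D≥0)   (mass-in {π} {w} e M)      E⊆S rewrite E⊆S π e = +-monoʳ-≤ w (mass-≤-weight D≥0 M E⊆S)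
  mass-≤-weight (w≥0 ∷ D≥0) (mass-out {D = D} _ M) {S} E⊆S =
    ≤-trans (mass-≤-weight D≥0 M E⊆S) (weight-≤-weight-∷ w≥0 D S)

  weight-≤-mass : ∀ {D : RandProj n m} {E r} → NonNegWeights D → Mass D E r →
    ∀ {S} → (∀ π → S π ≡ true → E π) → weight D S ≤ r
  weight-≤-mass []          mass-[]                   S⊆E = ≤-refl
  weight-≤-mass (w≥0 ∷ D≥0) (mass-in {π} {w} _ M) {S} S⊆E = +-mono-≤ (if-≤ (S π) {w} w≥0) (weight-≤-mass D≥0 M S⊆E)
  weight-≤-mass (_ ∷ D≥0)   (mass-out {π} ¬e M)   {S} S⊆E with S π in Sπ
  ... | true  = contradiction (S⊆E π Sπ) ¬e
  ... | false = ≤-trans (≤-reflexive (+-identityˡ _)) (weight-≤-mass D≥0 M S⊆E)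

  mass-weight : ∀ (D : RandProj n m) {E} (E? : Decidable E) → Mass D E (weight D (λ π → does (E? π)))
  mass-weight []            E? = mass-[]
  mass-weight ((π , w) ∷ D) E? with E? π
  ... | yes e  = mass-in e (mass-weight D E?)
  ... | no  ¬e = subst (Mass ((π , w) ∷ D) _) (sym (+-identityˡ _)) (mass-out ¬e (mass-weight D E?))

module _ {n m : ℕ} where

  Event : Set
  Event = Projection n m → Bool

  _⊆_ : Event → Event → Set
  S ⊆ T = ∀ π → S π ≡ true → T π ≡ true

  _≟ₜ_ : DecidableEquality (Target m)
  cst a   ≟ₜ cst b   = map′ (cong cst) (λ { refl → refl }) (a Bool.≟ b)
  cst _   ≟ₜ var _ _ = no λ ()
  var _ _ ≟ₜ cst _   = no λ ()
  var k a ≟ₜ var l b = map′ (λ (k≡l , a≡b) → cong₂ var k≡l a≡b) (λ { refl → refl , refl })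
                            (k Fin.≟ l ×-dec a Bool.≟ b)

  _≟ₚ_ : DecidableEquality (Projection n m)
  _≟ₚ_ = Vec.≡-dec _≟ₜ_

  FixedToward : Fin n → Bool → Projection n m → Projection n m → Set
  FixedToward i σ π p = ∃[ k ] ∃[ c ] (lookup p i ≡ var k c × substP p k σ ≡ π)

  fixedToward? : ∀ i σ π → Decidable (FixedToward i σ π)
  fixedToward? i σ π p with lookup p i
  ... | cst _   = no λ { (_ , _ , () , _) }
  ... | var k c = map′ (λ e → k , c , refl , e) (λ { (_ , _ , refl , e) → e }) (substP p k σ ≟ₚ π)

  FixingAt : RandProj n m → Bool → ℚ → Set₁
  FixingAt D σ q = ∀ π i a b → Mass D (FixedToward i σ π) a → Mass D (_≡ π) b → a ≤ q * b

  module _ {D : RandProj n m} (D≥0 : NonNegWeights D) {σ q} (fixing : FixingAt D σ q) (q≥0 : 0ℚ ≤ q)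
           (i : Fin n) (g : Projection n m → Projection n m) where

    FixedInto : Event → Event → Set
    FixedInto G S = ∀ π → G π ≡ true → S (g π) ≡ true × FixedToward i σ (g π) π

    weight-fixed-≤ : ∀ {G S} → FixedInto G S → ∀ y →
      weight D (λ π → G π ∧ does (g π ≟ₚ y)) ≤ q * weight D (λ π → S π ∧ does (π ≟ₚ y))
    weight-fixed-≤ {G} {S} G⇒ y with S y in Sy
    ... | true = begin
      weight D (λ π → G π ∧ does (g π ≟ₚ y))        ≤⟨ weight-mono D≥0 fixed-toward-y ⟩
      weight D (λ π → does (fixedToward? i σ y π))  ≤⟨ fixing y i _ _ (mass-weight D (fixedToward? i σ y))
                                                                      (mass-weight D (_≟ₚ y)) ⟩
      q * weight D (λ π → does (π ≟ₚ y))            ≡⟨ cong (q *_) (weight-cong D only-y) ⟩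
      q * weight D (λ π → S π ∧ does (π ≟ₚ y))      ∎
      where
      open ≤-Reasoning
      fixed-toward-y : ∀ π → G π ∧ does (g π ≟ₚ y) ≡ true → does (fixedToward? i σ y π) ≡ true
      fixed-toward-y π h with refl ← does-true⇒ (g π ≟ₚ y) (Bool.∧-conicalʳ _ _ h) =
        dec-true (fixedToward? i σ (g π) π) (proj₂ (G⇒ π (Bool.∧-conicalˡ _ _ h)))
      only-y : ∀ π → does (π ≟ₚ y) ≡ S π ∧ does (π ≟ₚ y)
      only-y π with π ≟ₚ y
      ... | yes refl = sym (cong (_∧ true) Sy)
      ... | no  _    = sym (Bool.∧-zeroʳ (S π))
    ... | false = begin
      weight D (λ π → G π ∧ does (g π ≟ₚ y))        ≡⟨ weight-zero (All.universal (Bool.¬-not ∘ y-unreached ∘ proj₁) D) ⟩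
      0ℚ                                            ≤⟨ *-nonNeg q≥0 (weight-nonNeg D≥0 _) ⟩
      q * weight D (λ π → S π ∧ does (π ≟ₚ y))      ∎
      where
      open ≤-Reasoning
      y-unreached : ∀ π → G π ∧ does (g π ≟ₚ y) ≢ true
      y-unreached π h with refl ← does-true⇒ (g π ≟ₚ y) (Bool.∧-conicalʳ _ _ h) =
        Bool.not-¬ Sy (proj₁ (G⇒ π (Bool.∧-conicalˡ _ _ h)))

    -- Grouping the fixed projections π by their image y = g π reduces the bound to one y at a time;
    -- the induction runs over a list of candidate images, so the support of D need not be deduplicated.
    fixing-bound : ∀ {G S} → FixedInto G S → weight D G ≤ q * weight D S
    fixing-bound G⇒ =
      bound-by-images (List.map (g ∘ proj₁) D) G⇒ (All.tabulate (λ e∈D _ → ∈-map⁺ (g ∘ proj₁) e∈D))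
      where
      open ≤-Reasoning
      bound-by-images : ∀ Ys {G S} → FixedInto G S → All (λ e → G (proj₁ e) ≡ true → g (proj₁ e) ∈ Ys) D →
        weight D G ≤ q * weight D S
      bound-by-images [] {G} {S} _ covered = begin
        weight D G      ≡⟨ weight-zero (All.map (λ gπ∈[] → Bool.¬-not (¬Any[] ∘ gπ∈[])) covered) ⟩
        0ℚ              ≤⟨ *-nonNeg q≥0 (weight-nonNeg D≥0 S) ⟩
        q * weight D S  ∎
      bound-by-images (y ∷ Ys) {G} {S} G⇒ covered = begin
        weight D G                         ≡⟨ weight-split D G (λ π → does (g π ≟ₚ y)) ⟩
        weight D G₌ + weight D G≠           ≤⟨ +-mono-≤ (weight-fixed-≤ G⇒ y) (bound-by-images Ys G≠⇒ covered′) ⟩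
        q * weight D S₌ + q * weight D S≠   ≡⟨ *-distribˡ-+ q _ _ ⟨
        q * (weight D S₌ + weight D S≠)     ≡⟨ cong (q *_) (weight-split D S (λ π → does (π ≟ₚ y))) ⟨
        q * weight D S                     ∎
        where
        G₌ G≠ S₌ S≠ : Event
        G₌ π = G π ∧ does (g π ≟ₚ y)
        G≠ π = G π ∧ not (does (g π ≟ₚ y))
        S₌ π = S π ∧ does (π ≟ₚ y)
        S≠ π = S π ∧ not (does (π ≟ₚ y))
        G≠⇒ : FixedInto G≠ S≠
        G≠⇒ π h = let (Sgπ , fixed) = G⇒ π (Bool.∧-conicalˡ _ _ h) in cong₂ _∧_ Sgπ (Bool.∧-conicalʳ _ _ h) , fixed
        other-image : ∀ {y′} → y′ ∈ y ∷ Ys → not (does (y′ ≟ₚ y)) ≡ true → y′ ∈ Ys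
        other-image (here refl)   y≢y = contradiction (trans (sym (cong not (dec-true (y ≟ₚ y) refl))) y≢y) λ ()
        other-image (there y′∈Ys) _   = y′∈Ys
        covered′ : All (λ e → G≠ (proj₁ e) ≡ true → g (proj₁ e) ∈ Ys) D
        covered′ = All.map (λ gπ∈ h → other-image (gπ∈ (Bool.∧-conicalˡ _ _ h)) (Bool.∧-conicalʳ _ _ h)) covered

_≟f_ : ∀ {k} (f g : BoolFun k) → Dec (f ≗f g)
_≟f_ {zero}  f g = map′ (λ { e [] → e }) (λ f≗g → f≗g []) (f [] Bool.≟ g [])
_≟f_ {suc k} f g =
  map′ (λ (f≗g₀ , f≗g₁) → λ { (false ∷ a) → f≗g₀ a ; (true ∷ a) → f≗g₁ a })
       (λ f≗g → (λ a → f≗g (false ∷ a)) , (λ a → f≗g (true ∷ a)))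
       ((λ a → f (false ∷ a)) ≟f (λ a → g (false ∷ a)) ×-dec (λ a → f (true ∷ a)) ≟f (λ a → g (true ∷ a)))

module _ {m : ℕ} where

  IsLiteral : BoolFun m → Set
  IsLiteral h = ∃[ k ] ∃[ ρ ] (h ≗f literalFun k ρ)

  isLiteral? : (h : BoolFun m) → Dec (IsLiteral h)
  isLiteral? h = any? λ k → map′ (λ { (inj₁ e) → false , e ; (inj₂ e) → true , e })
                                 (λ { (false , e) → inj₁ e ; (true , e) → inj₂ e })
                                 (h ≟f literalFun k false ⊎-dec h ≟f literalFun k true)

  leaves-positive : (φ : Formula m) → 1 ℕ.≤ leaves φ
  leaves-positive (leaf _ _) = ℕ.≤-refl
  leaves-positive (and φ _)  = ℕ.≤-trans (leaves-positive φ) (ℕ.m≤m+n _ _)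
  leaves-positive (or φ _)   = ℕ.≤-trans (leaves-positive φ) (ℕ.m≤m+n _ _)

  two-leaves : (φ ψ : Formula m) → 2 ℕ.≤ leaves φ ℕ.+ leaves ψ
  two-leaves φ ψ = ℕ.+-mono-≤ (leaves-positive φ) (leaves-positive ψ)

  single-leaf-literal : (φ : Formula m) → leaves φ ≡ 1 → IsLiteral (evalF φ)
  single-leaf-literal (leaf k ρ) _   = k , ρ , λ _ → refl
  single-leaf-literal (and φ ψ)  l≡1 = contradiction (subst (2 ℕ.≤_) l≡1 (two-leaves φ ψ)) (ℕ.<-irrefl refl)
  single-leaf-literal (or φ ψ)   l≡1 = contradiction (subst (2 ℕ.≤_) l≡1 (two-leaves φ ψ)) (ℕ.<-irrefl refl)

  IsL-1⇒¬Constant : ∀ {h : BoolFun m} → IsL h 1 → ¬ Constant h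
  IsL-1⇒¬Constant (inj₁ (_ , ()))
  IsL-1⇒¬Constant (inj₂ (¬constant , _)) = ¬constant

  IsL-1⇒IsLiteral : ∀ {h : BoolFun m} → IsL h 1 → IsLiteral h
  IsL-1⇒IsLiteral (inj₁ (_ , ()))
  IsL-1⇒IsLiteral (inj₂ (_ , (φ , l≡1 , φ≗h) , _)) =
    let (k , ρ , φ≗lit) = single-leaf-literal φ l≡1 in k , ρ , λ a → trans (sym (φ≗h a)) (φ≗lit a)

  literalFun-update : ∀ k ρ c (a : Vec Bool m) → literalFun k ρ (a [ k ]≔ c) ≡ c xor ρ
  literalFun-update k ρ c a = cong (_xor ρ) (Vec.lookup∘update k a c)

  literalFun-update′ : ∀ {j k} ρ c (a : Vec Bool m) → j ≢ k → literalFun j ρ (a [ k ]≔ c) ≡ literalFun j ρ a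
  literalFun-update′ ρ c a j≢k = cong (_xor ρ) (Vec.lookup∘update′ j≢k a c)

  evalT-substT : ∀ (a : Vec Bool m) k c t → evalT a (substT k c t) ≡ evalT (a [ k ]≔ c) t
  evalT-substT a k c (cst _)    = refl
  evalT-substT a k c (var k′ ρ) with k′ Fin.≟ k
  ... | yes refl = sym (literalFun-update k ρ c a)
  ... | no  k′≢k = sym (literalFun-update′ ρ c a k′≢k)

  substT-≢⇒var : ∀ (a : Vec Bool m) k t → evalT a (substT k false t) ≢ evalT a (substT k true t) →
    ∃[ c ] (t ≡ var k c)
  substT-≢⇒var a k (cst _)    differ = contradiction refl differ
  substT-≢⇒var a k (var k′ ρ) differ with k′ Fin.≟ k
  ... | yes refl = ρ , refl
  ... | no  _    = contradiction refl differ

restrict-substP : ∀ {n m} (f : BoolFun n) (π : Projection n m) k c a →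
  restrict f (substP π k c) a ≡ restrict f π (a [ k ]≔ c)
restrict-substP f π k c a =
  cong f (trans (sym (Vec.map-∘ (evalT a) (substT k c) π)) (Vec.map-cong (evalT-substT a k c) π))

adjacent-split : ∀ aᵤ aᵥ bᵤ bᵥ tᵤ tᵥ → (aᵤ ∧ bᵥ) ∨ (bᵤ ∧ aᵥ) ≡ true →
  not ((aᵤ ∧ (bᵥ ∧ tᵥ)) ∨ ((bᵤ ∧ tᵤ) ∧ aᵥ)) ≡ true →
  (aᵤ ∧ (bᵥ ∧ not tᵥ)) ∨ ((bᵤ ∧ not tᵤ) ∧ aᵥ) ≡ true
adjacent-split true  _     _     true  _     false _  _  = refl
adjacent-split true  _     _     true  _     true  _  ()
adjacent-split true  true  true  false false _     _  _  = refl
adjacent-split true  true  true  false true  _     _  ()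
adjacent-split false true  true  _     false _     _  _  = refl
adjacent-split false true  true  _     true  _     _  ()
adjacent-split true  false true  false _     _     () _
adjacent-split true  _     false false _     _     () _
adjacent-split false false false _     _     _     () _
adjacent-split false false true  _     _     _     () _
adjacent-split false true  false _     _     _     () _

module Edges {n m} (pivot : Projection n m → Fin m) (base : Vec Bool m) where

  toward : Bool → Projection n m → Projection n m
  toward c π = substP π (pivot π) c

  input : Projection n m → Vec Bool n
  input π = map (evalT base) π

  Adjacent : Event → Event → Event
  Adjacent SA SB π = (SA (toward false π) ∧ SB (toward true π)) ∨ (SB (toward false π) ∧ SA (toward true π))

  Separates : Formula n → Event → Event → Set
  Separates ψ SA SB = (∀ π → SA π ≡ true → evalF ψ (input π) ≡ true)
                    × (∀ π → SB π ≡ true → evalF ψ (input π) ≡ false)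

  PivotFixed : Fin n → Projection n m → Set
  PivotFixed i π = ∃[ c ] (lookup π i ≡ var (pivot π) c)

  FixedEdge : Fin n → Event → Event → Projection n m → Set
  FixedEdge i S S′ π = S (toward false π) ≡ true × S′ (toward true π) ≡ true × PivotFixed i π

  lookup-input-toward : ∀ π i c → lookup (input (toward c π)) i ≡ evalT base (substT (pivot π) c (lookup π i))
  lookup-input-toward π i c = trans (Vec.lookup-map i (evalT base) (toward c π))
                                    (cong (evalT base) (Vec.lookup-map i (substT (pivot π) c) π))

  leaf-flip⇒PivotFixed : ∀ π i β →
    evalF (leaf i β) (input (toward false π)) ≢ evalF (leaf i β) (input (toward true π)) → PivotFixed i π
  leaf-flip⇒PivotFixed π i β flips = substT-≢⇒var base (pivot π) (lookup π i) λ e →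
    flips (cong (_xor β) (trans (lookup-input-toward π i false) (trans e (sym (lookup-input-toward π i true)))))

module Khrapchenko {n m} {D : RandProj n m} (D≥0 : NonNegWeights D) {q₀ q₁ : ℚ}
                   (q₀≥0 : 0ℚ ≤ q₀) (q₁≥0 : 0ℚ ≤ q₁) (fixing : IsFixing D q₀ q₁)
                   (pivot : Projection n m → Fin m) (base : Vec Bool m) where

  open Edges pivot base

  W : Event → ℚ
  W = weight D

  Bounded : ℕ → Event → Event → Set
  Bounded l SA SB = ∀ SE → SE ⊆ Adjacent SA SB → W SE * W SE ≤ (toℚ 4 * (q₀ * q₁) * toℚ l * W SA) * W SB

  Bounded-swap : ∀ {l SA SB} → Bounded l SA SB → Bounded l SB SA
  Bounded-swap {l} {SA} {SB} bounded SE SE⊆ =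
    ≤-trans (bounded SE λ π h → trans (Bool.∨-comm (SA (toward false π) ∧ SB (toward true π)) _) (SE⊆ π h))
            (≤-reflexive (solve 3 (λ C A B → (C :* A) :* B := (C :* B) :* A)
                                  refl (toℚ 4 * (q₀ * q₁) * toℚ l) (W SA) (W SB)))

  Bounded-split : ∀ {l₁ l₂ SA SB} T →
    Bounded l₁ SA (λ π → SB π ∧ T π) → Bounded l₂ SA (λ π → SB π ∧ not (T π)) → Bounded (l₁ ℕ.+ l₂) SA SB
  Bounded-split {l₁} {l₂} {SA} {SB} T bounded₁ bounded₂ SE SE⊆ = begin
    W SE * W SE                                      ≡⟨ cong (λ x → x * x) (weight-split D SE (Adjacent SA SB₁)) ⟩
    (W SE₁ + W SE₂) * (W SE₁ + W SE₂)                ≤⟨ cauchy-schwarz₂ (W SE₁) (W SE₂)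
                                                          (coeff≥0 l₁) (weight-nonNeg D≥0 SB₁)
                                                          (coeff≥0 l₂) (weight-nonNeg D≥0 SB₂)
                                                          (bounded₁ SE₁ (λ π → Bool.∧-conicalʳ (SE π) _)) (bounded₂ SE₂ SE₂⊆) ⟩
    (coeff l₁ + coeff l₂) * (W SB₁ + W SB₂)          ≡⟨ solve 5 (λ C x y A B → (C :* x :* A :+ C :* y :* A) :* B
                                                                           := (C :* (x :+ y) :* A) :* B)
                                                                 refl C (toℚ l₁) (toℚ l₂) (W SA) (W SB₁ + W SB₂) ⟩
    (C * (toℚ l₁ + toℚ l₂) * W SA) * (W SB₁ + W SB₂) ≡⟨ cong₂ (λ l B → (C * l * W SA) * B)
                                                               (toℚ-+ l₁ l₂) (weight-split D SB T) ⟨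
    coeff (l₁ ℕ.+ l₂) * W SB                         ∎
    where
    open ≤-Reasoning
    C = toℚ 4 * (q₀ * q₁)
    coeff : ℕ → ℚ
    coeff l = C * toℚ l * W SA
    coeff≥0 : ∀ l → 0ℚ ≤ coeff l
    coeff≥0 l = *-nonNeg (*-nonNeg (*-nonNeg (toℚ-nonNeg 4) (*-nonNeg q₀≥0 q₁≥0)) (toℚ-nonNeg l)) (weight-nonNeg D≥0 SA)
    SB₁ SB₂ SE₁ SE₂ : Event
    SB₁ π = SB π ∧ T π
    SB₂ π = SB π ∧ not (T π)
    SE₁ π = SE π ∧ Adjacent SA SB₁ π
    SE₂ π = SE π ∧ not (Adjacent SA SB₁ π)
    SE₂⊆ : SE₂ ⊆ Adjacent SA SB₂
    SE₂⊆ π h = adjacent-split (SA (toward false π)) (SA (toward true π)) (SB (toward false π)) (SB (toward true π))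
                              (T (toward false π)) (T (toward true π))
                              (SE⊆ π (Bool.∧-conicalˡ (SE π) _ h)) (Bool.∧-conicalʳ (SE π) _ h)

  edge-bounds : ∀ i {G S S′} → (∀ π → G π ≡ true → FixedEdge i S S′ π) → W G ≤ q₀ * W S × W G ≤ q₁ * W S′
  edge-bounds i G⇒ =
    fixing-bound D≥0 (λ π → fixing π false) q₀≥0 i (toward false)
      (λ π h → let (s , _ , c , πᵢ) = G⇒ π h in s , pivot π , c , πᵢ , refl) ,
    fixing-bound D≥0 (λ π → fixing π true) q₁≥0 i (toward true)
      (λ π h → let (_ , s′ , c , πᵢ) = G⇒ π h in s′ , pivot π , c , πᵢ , refl)

  leaf-bounded : ∀ i β {SA SB} → Separates (leaf i β) SA SB → Bounded 1 SA SB
  leaf-bounded i β {SA} {SB} (A⇒ , B⇒) SE SE⊆ = begin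
    W SE * W SE                                    ≡⟨ cong (λ x → x * x) (weight-split D SE forward) ⟩
    (W G₁ + W G₂) * (W G₁ + W G₂)                  ≤⟨ square-+-≤ (W G₁) (W G₂) ⟩
    toℚ 2 * (W G₁ * W G₁) + toℚ 2 * (W G₂ * W G₂)  ≤⟨ +-mono-≤ (double (*-mono-≤-nonNeg G₁≥0 G₁≥0 G₁≤q₀A G₁≤q₁B))
                                                              (double (*-mono-≤-nonNeg G₂≥0 G₂≥0 G₂≤q₀B G₂≤q₁A)) ⟩
    toℚ 2 * ((q₀ * W SA) * (q₁ * W SB)) + toℚ 2 * ((q₀ * W SB) * (q₁ * W SA))
                                                   ≡⟨ solve 4 (λ q₀ q₁ A B → con (toℚ 2) :* ((q₀ :* A) :* (q₁ :* B))
                                                                          :+ con (toℚ 2) :* ((q₀ :* B) :* (q₁ :* A))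
                                                                          := (con (toℚ 4) :* (q₀ :* q₁) :* con (toℚ 1) :* A) :* B)
                                                               refl q₀ q₁ (W SA) (W SB) ⟩
    (toℚ 4 * (q₀ * q₁) * toℚ 1 * W SA) * W SB       ∎
    where
    open ≤-Reasoning
    double : ∀ {p q} → p ≤ q → toℚ 2 * p ≤ toℚ 2 * q
    double = *-monoˡ-≤-nonNeg (toℚ 2) {{normalize-nonNeg 2 1}}
    forward G₁ G₂ : Event
    forward π = SA (toward false π) ∧ SB (toward true π)
    G₁ π = SE π ∧ forward π
    G₂ π = SE π ∧ not (forward π)
    G₁≥0 = weight-nonNeg D≥0 G₁
    G₂≥0 = weight-nonNeg D≥0 G₂
    G₁⇒ : ∀ π → G₁ π ≡ true → FixedEdge i SA SB π
    G₁⇒ π h = a , b , leaf-flip⇒PivotFixed π i β (λ e → Bool.not-¬ (A⇒ _ a) (trans e (B⇒ _ b)))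
      where
      a = Bool.∧-conicalˡ _ _ (Bool.∧-conicalʳ (SE π) _ h)
      b = Bool.∧-conicalʳ (SA (toward false π)) _ (Bool.∧-conicalʳ (SE π) _ h)
    G₂⇒ : ∀ π → G₂ π ≡ true → FixedEdge i SB SA π
    G₂⇒ π h = b , a , leaf-flip⇒PivotFixed π i β (λ e → Bool.not-¬ (A⇒ _ a) (trans (sym e) (B⇒ _ b)))
      where
      backward = ∨-true-false (SE⊆ π (Bool.∧-conicalˡ (SE π) _ h)) (not-true (Bool.∧-conicalʳ (SE π) _ h))
      b = Bool.∧-conicalˡ _ _ backward
      a = Bool.∧-conicalʳ (SB (toward false π)) _ backward
    G₁≤q₀A = proj₁ (edge-bounds i {G₁} {SA} {SB} G₁⇒)
    G₁≤q₁B = proj₂ (edge-bounds i {G₁} {SA} {SB} G₁⇒)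
    G₂≤q₀B = proj₁ (edge-bounds i {G₂} {SB} {SA} G₂⇒)
    G₂≤q₁A = proj₂ (edge-bounds i {G₂} {SB} {SA} G₂⇒)

  khrapchenko : ∀ ψ {SA SB} → Separates ψ SA SB → Bounded (leaves ψ) SA SB
  khrapchenko (leaf i β) separates = leaf-bounded i β separates
  khrapchenko (and ψ₁ ψ₂) {SA} {SB} (A⇒ , B⇒) =
    Bounded-split {leaves ψ₁} {leaves ψ₂} T (khrapchenko ψ₁ separates₁) (khrapchenko ψ₂ separates₂)
    where
    T : Event
    T π = evalF ψ₂ (input π)
    separates₁ : Separates ψ₁ SA (λ π → SB π ∧ T π)
    separates₁ = (λ π a → Bool.∧-conicalˡ _ _ (A⇒ π a))
               , (λ π b → ∧-false-true (B⇒ π (Bool.∧-conicalˡ (SB π) _ b)) (Bool.∧-conicalʳ (SB π) _ b))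
    separates₂ : Separates ψ₂ SA (λ π → SB π ∧ not (T π))
    separates₂ = (λ π a → Bool.∧-conicalʳ (evalF ψ₁ (input π)) _ (A⇒ π a))
               , (λ π b → not-true (Bool.∧-conicalʳ (SB π) _ b))
  khrapchenko (or ψ₁ ψ₂) {SA} {SB} (A⇒ , B⇒) =
    Bounded-swap {leaves ψ₁ ℕ.+ leaves ψ₂} {SB} {SA}
      (Bounded-split {leaves ψ₁} {leaves ψ₂} T (Bounded-swap {leaves ψ₁} (khrapchenko ψ₁ separates₁))
                                               (Bounded-swap {leaves ψ₂} (khrapchenko ψ₂ separates₂)))
    where
    T : Event
    T π = evalF ψ₁ (input π)
    separates₁ : Separates ψ₁ (λ π → SA π ∧ T π) SB
    separates₁ = (λ π a → Bool.∧-conicalʳ (SA π) _ a)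
               , (λ π b → Bool.∨-conicalˡ _ _ (B⇒ π b))
    separates₂ : Separates ψ₂ (λ π → SA π ∧ not (T π)) SB
    separates₂ = (λ π a → ∨-true-false (A⇒ π (Bool.∧-conicalˡ (SA π) _ a)) (not-true (Bool.∧-conicalʳ (SA π) _ a)))
               , (λ π b → Bool.∨-conicalʳ (evalF ψ₁ (input π)) _ (B⇒ π b))

  khrapchenko-bound : ∀ ψ {SA SB SE b} → Separates ψ SA SB → SE ⊆ Adjacent SA SB → W SA + W SB ≤ b →
    W SE * W SE ≤ (q₀ * q₁) * (toℚ (leaves ψ) * (b * b))
  khrapchenko-bound ψ {SA} {SB} {SE} {b} separates SE⊆ A+B≤b = begin
    W SE * W SE                              ≤⟨ khrapchenko ψ separates SE SE⊆ ⟩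
    (toℚ 4 * (q₀ * q₁) * L * W SA) * W SB     ≡⟨ solve 5 (λ q₀ q₁ L A B → (con (toℚ 4) :* (q₀ :* q₁) :* L :* A) :* B
                                                                   := (q₀ :* q₁) :* (L :* (con (toℚ 4) :* A :* B)))
                                                         refl q₀ q₁ L (W SA) (W SB) ⟩
    (q₀ * q₁) * (L * (toℚ 4 * W SA * W SB))   ≤⟨ *-monoˡ-≤-nonNeg (q₀ * q₁) {{nonNegative (*-nonNeg q₀≥0 q₁≥0)}}
                                                  (*-monoˡ-≤-nonNeg L {{nonNegative (toℚ-nonNeg (leaves ψ))}} 4AB≤b²) ⟩
    (q₀ * q₁) * (L * (b * b))                 ∎
    where
    open ≤-Reasoning
    L = toℚ (leaves ψ)
    A+B≥0 = +-mono-≤ (weight-nonNeg D≥0 SA) (weight-nonNeg D≥0 SB)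
    4AB≤b² = ≤-trans (four-*-≤-square-+ (W SA) (W SB)) (*-mono-≤-nonNeg A+B≥0 A+B≥0 A+B≤b A+B≤b)

module LiteralRestriction {n m} (f₁ f₂ : BoolFun n) (σ τ : Bool) (j : Fin m) where

  restricted : Projection n m → BoolFun m
  restricted π = restrict f₂ (substP π j σ)

  inB : Event
  inB π = does (restrict f₁ π ≟f literalFun j τ)

  -- j is a junk value: pivot π is only used when restricted π is a literal.
  pivot : Projection n m → Fin m
  pivot π with isLiteral? (restricted π)
  ... | yes (k , _) = k
  ... | no  _       = j

  pivot-literal : ∀ π → IsLiteral (restricted π) → ∃[ ρ ] (restricted π ≗f literalFun (pivot π) ρ)
  pivot-literal π literal with isLiteral? (restricted π)
  ... | yes (_ , ρ , lit) = ρ , lit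
  ... | no  ¬literal      = contradiction literal ¬literal

  zeros : Vec Bool m
  zeros = replicate m false

  -- Chosen so that f₂ (input π) = restricted π zeros.
  base : Vec Bool m
  base = zeros [ j ]≔ σ

  restricted-update-j : ∀ π c a → restricted π (a [ j ]≔ c) ≡ restricted π a
  restricted-update-j π c a = begin
    restricted π (a [ j ]≔ c)             ≡⟨ restrict-substP f₂ π j σ (a [ j ]≔ c) ⟩
    restrict f₂ π ((a [ j ]≔ c) [ j ]≔ σ) ≡⟨ cong (restrict f₂ π) (Vec.[]≔-idempotent a j) ⟩
    restrict f₂ π (a [ j ]≔ σ)            ≡⟨ restrict-substP f₂ π j σ a ⟨
    restricted π a                        ∎
    where open ≡-Reasoning

  literal-var≢j : ∀ {π k ρ} → restricted π ≗f literalFun k ρ → k ≢ j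
  literal-var≢j {π} {k} {ρ} lit refl = Bool.not-¬ refl (begin
    ρ                                   ≡⟨ literalFun-update k ρ false zeros ⟨
    literalFun k ρ (zeros [ k ]≔ false) ≡⟨ lit _ ⟨
    restricted π (zeros [ k ]≔ false)   ≡⟨ restricted-update-j π false zeros ⟩
    restricted π zeros                  ≡⟨ restricted-update-j π true zeros ⟨
    restricted π (zeros [ k ]≔ true)    ≡⟨ lit _ ⟩
    literalFun k ρ (zeros [ k ]≔ true)  ≡⟨ literalFun-update k ρ true zeros ⟩
    not ρ                               ∎)
    where open ≡-Reasoning

  open Edges pivot base

  inB-toward : ∀ {π} c → inB π ≡ true → pivot π ≢ j → inB (toward c π) ≡ true
  inB-toward {π} c inBπ k≢j = dec-true (restrict f₁ (toward c π) ≟f literalFun j τ) λ a → begin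
    restrict f₁ (toward c π) a        ≡⟨ restrict-substP f₁ π (pivot π) c a ⟩
    restrict f₁ π (a [ pivot π ]≔ c)  ≡⟨ does-true⇒ (restrict f₁ π ≟f literalFun j τ) inBπ _ ⟩
    literalFun j τ (a [ pivot π ]≔ c) ≡⟨ literalFun-update′ τ c a (k≢j ∘ sym) ⟩
    literalFun j τ a                  ∎
    where open ≡-Reasoning

  f₂-toward : ∀ {π ρ} c → restricted π ≗f literalFun (pivot π) ρ → f₂ (input (toward c π)) ≡ c xor ρ
  f₂-toward {π} {ρ} c lit = begin
    restrict f₂ (toward c π) base             ≡⟨ restrict-substP f₂ π k c base ⟩
    restrict f₂ π ((zeros [ j ]≔ σ) [ k ]≔ c) ≡⟨ cong (restrict f₂ π) (Vec.[]≔-commutes zeros j k j≢k) ⟩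
    restrict f₂ π ((zeros [ k ]≔ c) [ j ]≔ σ) ≡⟨ restrict-substP f₂ π j σ (zeros [ k ]≔ c) ⟨
    restricted π (zeros [ k ]≔ c)             ≡⟨ lit _ ⟩
    literalFun k ρ (zeros [ k ]≔ c)           ≡⟨ literalFun-update k ρ c zeros ⟩
    c xor ρ                                   ∎
    where
    open ≡-Reasoning
    k = pivot π
    j≢k = literal-var≢j lit ∘ sym

  SA SB Ed : Event
  SA π = inB π ∧ f₂ (input π)
  SB π = inB π ∧ not (f₂ (input π))
  Ed π = inB π ∧ does (isLiteral? (restricted π))

  literal-adjacent : ∀ {π ρ} → inB π ≡ true → restricted π ≗f literalFun (pivot π) ρ → Adjacent SA SB π ≡ true
  literal-adjacent {π} {ρ} inBπ lit
    rewrite inB-toward false inBπ (literal-var≢j lit) | inB-toward true inBπ (literal-var≢j lit)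
          | f₂-toward false lit | f₂-toward true lit = one-side ρ
    where
    one-side : ∀ ρ → (ρ ∧ not (not ρ)) ∨ (not ρ ∧ not ρ) ≡ true
    one-side false = refl
    one-side true  = refl

  Ed-adjacent : Ed ⊆ Adjacent SA SB
  Ed-adjacent π h = literal-adjacent (Bool.∧-conicalˡ (inB π) _ h) (proj₂ (pivot-literal π literal))
    where
    literal = does-true⇒ (isLiteral? (restricted π)) (Bool.∧-conicalʳ (inB π) _ h)

lemma3p11 : ∀ {n m} (D : RandProj n m) (q₀ q₁ : ℚ) →
    IsDistribution D → 0ℚ ≤ q₀ → 0ℚ ≤ q₁ → IsFixing D q₀ q₁ →
    (f₁ f₂ : BoolFun n) (σ τ : Bool) (j : Fin m) (ℓ : ℕ) → IsL f₂ ℓ →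
    (a b : ℚ) →
    Mass D (λ p → IsL (restrict f₂ (substP p j σ)) 1 × restrict f₁ p ≗f literalFun j τ) a →
    Mass D (λ p → restrict f₁ p ≗f literalFun j τ) b →
    a * a ≤ (q₀ * q₁) * ((+ ℓ / 1) * (b * b))
lemma3p11 D q₀ q₁ (D≥0 , _) q₀≥0 q₁≥0 _ f₁ f₂ σ τ j _ (inj₁ ((c , constant) , refl)) a b massA _ =
  subst (λ x → x * x ≤ _) (sym a≡0) (*-nonNeg (*-nonNeg q₀≥0 q₁≥0) (*-nonNeg (toℚ-nonNeg 0) (square-nonNeg b)))
  where
  a≡0 = mass-empty (λ π (isL , _) → IsL-1⇒¬Constant isL (c , λ _ → constant _)) massA
lemma3p11 D q₀ q₁ (D≥0 , _) q₀≥0 q₁≥0 fixing f₁ f₂ σ τ j _ (inj₂ (_ , (φ , refl , φ≗f₂) , _)) a b massA massB =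
  ≤-trans (*-mono-≤-nonNeg a≥0 a≥0 a≤W[Ed] a≤W[Ed]) (khrapchenko-bound φ separates Ed-adjacent A+B≤b)
  where
  open LiteralRestriction f₁ f₂ σ τ j
  open Edges pivot base
  open Khrapchenko D≥0 q₀≥0 q₁≥0 fixing pivot base
  a≥0 = mass-nonNeg D≥0 massA
  a≤W[Ed] = mass-≤-weight D≥0 massA λ π (isL , f₁|π) →
    cong₂ _∧_ (dec-true (restrict f₁ π ≟f literalFun j τ) f₁|π) (dec-true (isLiteral? (restricted π)) (IsL-1⇒IsLiteral isL))
  A+B≤b = ≤-trans (≤-reflexive (sym (weight-split D inB (λ π → f₂ (input π)))))
                  (weight-≤-mass D≥0 massB λ π → does-true⇒ (restrict f₁ π ≟f literalFun j τ))
  separates : Separates φ SA SB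
  separates = (λ π h → trans (φ≗f₂ _) (Bool.∧-conicalʳ (inB π) _ h))
            , (λ π h → trans (φ≗f₂ _) (not-true (Bool.∧-conicalʳ (inB π) _ h)))
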